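{- Let $n\ge2$, $\lambda$ a partition with at most $n-1$ non-zero parts, $w\in S_n$ any permutation and $T$ any subsequence of $\Gamma$ (not necessarily forming an admissible pair with $w$). Then $\mathrm{ct}(f(w,T))=w(\mu(T))$ in $\mathbb{Z}^n$. In particular, $w(\mu(T))$ depends only on the filling $f(w,T)$.
   Context: Permutations in one-line notation; $(a,b)$, $a<b$, denotes a transposition; for a sequence of transpositions $T=(t_1,\dots,t_s)$, $wT:=wt_1\cdots t_s$ (right multiplication by $(a,b)$ swaps entries in positions $a,b$). $S_n$ acts on $\mathbb{Z}^n$ by $(w\mu)_{w(i)}=\mu_i$. $\lambda'_j=\#\{i:\lambda_i\ge j\}$. For $1\le k\le n-1$, $\Gamma(k)=((1,n),(1,n-1),\dots,(1,k+1),(2,n),\dots,(2,k+1),\dots,(k,n),\dots,(k,k+1))$; $\Gamma=\Gamma_{\lambda_1}\cdots\Gamma_1$ (concatenation) with $\Gamma_j=\Gamma(\lambda'_j)$, written $\Gamma=(\beta_1,\dots,\beta_m)$. A subsequence $T$ corresponds to positions $j_1<\dots<j_s$, and splits as $T=T_{\lambda_1}\cdots T_1$ with $T_j$ the entries in segment $\Gamma_j$. If $\beta_k=(a,b)$, let $l_k=\#\{i\le k:\beta_i=\beta_k\}$ and let $\hat r_k:\mathbb{Z}^n\to\mathbb{Z}^n$ replace $\mu_a$ by $\mu_b+l_k$ and $\mu_b$ by $\mu_a-l_k$; $\mu(T):=\hat r_{j_1}\cdots\hat r_{j_s}(\lambda)$. Filling map: $\pi_j=wT_{\lambda_1}\cdots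 T_{j+1}$ and $f(w,T)$ is the filling of the Young diagram of $\lambda$ with $f(w,T)(i,j)=\pi_j(i)$ for cells $(i,j)$, $1\le j\le\lambda_i$. $\mathrm{ct}(\sigma)=(c_1,\dots,c_n)$ with $c_i$ the number of entries equal to $i$. -}

module Defs where

open import Data.Nat using (ℕ; zero; suc; _≤_; _<_; _≤?_; _<?_; _∸_)
open import Data.Nat.Properties using ()
open import Data.Integer using (ℤ; +_; _+_; _-_)
open import Data.Fin using (Fin; toℕ; _≟_)
open import Data.Fin.Permutation using (Permutation′; _⟨$⟩ʳ_; _⟨$⟩ˡ_)
import Data.Fin.Permutation.Components as PC
open import Data.List using (List; []; _∷_; map; concatMap; filter; allFin; downFrom; reverse; length; foldr)
open import Data.Nat.ListAction using (sum)
open import Data.Vec using (Vec; toList)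
open import Data.Bool using (Bool; true; false; if_then_else_)
open import Data.Product using (_×_; _,_; proj₁; proj₂)
open import Data.Product.Properties using (≡-dec)
open import Relation.Nullary using (does; Dec)
open import Relation.Nullary.Decidable using (_×-dec_)
open import Relation.Binary.PropositionalEquality using (_≡_)

-- Conventions: positions 1..n of the paper are Fin n = {0,…,n-1} here.
-- A permutation w ∈ S_n is a stdlib Permutation′ n, w(i) = w ⟨$⟩ʳ i.

module _ {n : ℕ} where

  -- λ (as a vector in ℕⁿ, padded by zeros) is a partition: weakly decreasing.
  IsPartition : (Fin n → ℕ) → Set
  IsPartition λ′ = ∀ (i j : Fin n) → toℕ i ≤ toℕ j → λ′ j ≤ λ′ i

  nonzeroParts : (Fin n → ℕ) → ℕ
  nonzeroParts λ′ = length (filter (λ i → 0 <? λ′ i) (allFin n))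

  first : (Fin n → ℕ) → ℕ
  first λ′ = go n λ′
    where
    go : (m : ℕ) → (Fin m → ℕ) → ℕ
    go zero    _  = 0
    go (suc m) f  = f Fin.zero

  conj : (Fin n → ℕ) → ℕ → ℕ
  conj λ′ j = length (filter (λ i → j ≤? λ′ i) (allFin n))

  -- Γ(k) = ((1,n),(1,n-1),…,(1,k+1),(2,n),…,(2,k+1),…,(k,n),…,(k,k+1))
  -- (1-indexed); 0-indexed: a ranges over toℕ a < k increasingly,
  -- b over toℕ b ≥ k decreasingly.
  Γk : ℕ → List (Fin n × Fin n)
  Γk k = concatMap (λ a → map (λ b → (a , b))
                               (reverse (filter (λ b → k ≤? toℕ b) (allFin n))))
                   (filter (λ a → suc (toℕ a) ≤? k) (allFin n))

  -- Γ = Γ_{λ₁} ⋯ Γ_1, each entry tagged with its segment index j.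
  ΓSeg : (Fin n → ℕ) → List (ℕ × (Fin n × Fin n))
  ΓSeg λ′ = concatMap (λ j → map (λ ab → (j , ab)) (Γk (conj λ′ j)))
                      (map suc (downFrom (first λ′)))

  Γ : (Fin n → ℕ) → List (Fin n × Fin n)
  Γ λ′ = map proj₂ (ΓSeg λ′)

  pairEq? : (x y : Fin n × Fin n) → Dec (x ≡ y)
  pairEq? = ≡-dec _≟_ _≟_

  -- l_k = #{ i ≤ k : β_i = β_k }, computed along the list
  -- (seen = β_1,…,β_{k-1} in reverse order)
  lCounts : List (Fin n × Fin n) → List (Fin n × Fin n) → List ℕ
  lCounts seen []       = []
  lCounts seen (x ∷ xs) = suc (length (filter (pairEq? x) seen)) ∷ lCounts (x ∷ seen) xs

  zip3 : {A B C : Set} → List A → List B → List C → List (A × B × C)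
  zip3 (a ∷ as) (b ∷ bs) (c ∷ cs) = (a , b , c) ∷ zip3 as bs cs
  zip3 _ _ _ = []

  -- Γ with full annotation: (segment j, l_k, β_k)
  ΓAnn : (Fin n → ℕ) → List (ℕ × ℕ × (Fin n × Fin n))
  ΓAnn λ′ = zip3 (map proj₁ (ΓSeg λ′)) (lCounts [] (Γ λ′)) (Γ λ′)

  select : {A : Set} → List A → List Bool → List A
  select (x ∷ xs) (true  ∷ bs) = x ∷ select xs bs
  select (x ∷ xs) (false ∷ bs) = select xs bs
  select _ _ = []

  Subseq : (Fin n → ℕ) → Set
  Subseq λ′ = Vec Bool (length (Γ λ′))

  selected : (λ′ : Fin n → ℕ) → Subseq λ′ → List (ℕ × ℕ × (Fin n × Fin n))
  selected λ′ T = select (ΓAnn λ′) (toList T)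

  rhat : ℕ → Fin n × Fin n → (Fin n → ℤ) → (Fin n → ℤ)
  rhat l (a , b) μ i =
    if does (i ≟ a) then μ b + + l
    else if does (i ≟ b) then μ a - + l
    else μ i

  μT : (λ′ : Fin n → ℕ) → Subseq λ′ → (Fin n → ℤ)
  μT λ′ T = foldr (λ e μ → rhat (proj₁ (proj₂ e)) (proj₂ (proj₂ e)) μ)
                  (λ i → + λ′ i) (selected λ′ T)

  -- action of S_n on ℤⁿ : (wμ)_{w(i)} = μ_i, i.e. (wμ)_c = μ_{w⁻¹(c)}
  act : Permutation′ n → (Fin n → ℤ) → (Fin n → ℤ)
  act w μ c = μ (w ⟨$⟩ˡ c)

  -- right multiplication w t₁ ⋯ t_s as functions (one-line notation)
  rmul : (Fin n → Fin n) → List (Fin n × Fin n) → (Fin n → Fin n)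
  rmul w []             = w
  rmul w ((a , b) ∷ ts) = rmul (λ i → w (PC.transpose a b i)) ts

  -- π_j = w T_{λ₁} ⋯ T_{j+1}
  πj : (λ′ : Fin n → ℕ) → Permutation′ n → Subseq λ′ → ℕ → (Fin n → Fin n)
  πj λ′ w T j = rmul (w ⟨$⟩ʳ_)
                  (map (λ e → proj₂ (proj₂ e))
                       (filter (λ e → suc j ≤? proj₁ e) (selected λ′ T)))

  filling : (λ′ : Fin n → ℕ) → Permutation′ n → Subseq λ′ → Fin n → ℕ → Fin n
  filling λ′ w T i j = πj λ′ w T j i

  IsCell : (Fin n → ℕ) → Fin n → ℕ → Set
  IsCell λ′ i j = 1 ≤ j × j ≤ λ′ i

  ct : (Fin n → ℕ) → (Fin n → ℕ → Fin n) → Fin n → ℕ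
  ct λ′ σ c = sum (map (λ j → length (filter (λ i → (j ≤? λ′ i) ×-dec (σ i j ≟ c)) (allFin n)))
                       (map suc (downFrom (first λ′))))

module Submission where

-- View T as a list of entries (j, l, (a,b)): segment j, label l_k and transposition β_k.
-- Column j of f(w,T) is the bijection π_j = w·(transpositions of the segments > j), so c
-- occurs in column j iff row π_j⁻¹(c) has length ≥ j: ct(f(w,T))_c = Σ_j [j ≤ λ(π_j⁻¹ c)]
-- (ct-filling). By
-- induction on L: the first entry moves row p to (a,b)(p) in the columns < s and leaves the
-- columns ≥ s alone, which is exactly the effect of r̂. Next it shows that Γ itself is
-- ordered and labelled (Γ-ordered, Γ-labelled): (a,b) lies in Γ_j iff λ_b < j ≤ λ_a, and then
-- once. Both properties pass to subsequences, giving the theorem; its second half holds as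
-- the content only depends on the entries in the cells (ct-cong).

open import Defs
open import Data.Nat using (ℕ; zero; suc; _+_; _*_; _∸_; _⊓_; _≤_; _<_; _≤?_; z≤n; s≤s)
open import Data.Nat.Properties
  using (+-commutativeSemigroup; +-identityʳ; +-assoc; +-comm; *-distribʳ-+; +-∸-assoc; m∸n+n≡m; +-cancelʳ-≡; m≤n⇒m∸n≡0;
         m≤n⇒m⊓n≡m; m≥n⇒m⊓n≡n; ≤-refl; ≤-trans; <-≤-trans; <⇒≤; ≤-pred; <⇒≱; ≰⇒>; ≮⇒≥; n≮0; n≮n)
open import Data.Nat.ListAction using (sum)
open import Algebra.Properties.CommutativeSemigroup +-commutativeSemigroup using (interchange)
open import Data.Integer as ℤ using (ℤ; +_)
import Data.Integer.Properties as ℤₚ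
open import Data.Integer.Tactic.RingSolver using (solve-∀)
open import Data.Fin using (Fin; toℕ; _≟_) renaming (zero to fzero; suc to fsuc)
import Data.Fin.Properties as Finₚ
open import Data.Fin.Permutation using (Permutation′; _⟨$⟩ˡ_; inverseˡ; inverseʳ)
import Data.Fin.Permutation.Components as PC
open import Data.Bool using (Bool; true; false; if_then_else_)
open import Data.List
  using (List; []; _∷_; _++_; _ʳ++_; map; filter; foldr; length; reverse; allFin; tabulate; downFrom;
         concatMap; cartesianProduct)
open import Data.List.Properties
  using (filter-++; length-++; filter-none; filter-≐; filter-accept; filter-reject; map-tabulate;
         ʳ++-defn; map-∘; map-id; map-cong-local)
open import Data.List.Relation.Unary.All as All using (All; []; _∷_)
import Data.List.Relation.Unary.All.Properties as Allₚ
open import Data.List.Relation.Unary.AllPairs using (AllPairs; []; _∷_)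
import Data.List.Relation.Unary.AllPairs.Properties as AllPairsₚ
open import Data.List.Relation.Unary.Unique.Propositional using (Unique)
import Data.List.Relation.Unary.Unique.Propositional.Properties as Uniqueₚ
open import Data.List.Relation.Binary.Permutation.Propositional using (↭⇒↭ₛ; ↭-sym)
open import Data.List.Relation.Binary.Permutation.Propositional.Properties
  using (↭-reverse; ↭-length; filter-↭; All-resp-↭)
import Data.List.Relation.Binary.Permutation.Setoid.Properties as Permₛ
open import Data.Vec using (toList)
open import Data.Product using (_×_; _,_; proj₁; proj₂)
open import Function using (_∘_; id; _⇔_; mk⇔; Equivalence)
open import Relation.Nullary using (Dec; yes; no; does; ¬_)
open import Relation.Nullary.Decidable using (_×-dec_)
open import Relation.Nullary.Negation using (contradiction)
open import Relation.Unary using (Decidable)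
open import Relation.Binary.PropositionalEquality
  using (_≡_; _≢_; refl; sym; trans; cong; cong₂; subst; setoid; module ≡-Reasoning)
open ≡-Reasoning
open Equivalence using (to; from)

𝟙 : {P : Set} → Dec P → ℕ
𝟙 d = if does d then 1 else 0

𝟙-yes : {P : Set} (d : Dec P) → P → 𝟙 d ≡ 1
𝟙-yes (yes _) _ = refl
𝟙-yes (no ¬p) p = contradiction p ¬p

𝟙-no : {P : Set} (d : Dec P) → ¬ P → 𝟙 d ≡ 0
𝟙-no (yes p) ¬p = contradiction p ¬p
𝟙-no (no _)  _  = refl

𝟙-cong : {P Q : Set} (d : Dec P) (e : Dec Q) → (P → Q) → (Q → P) → 𝟙 d ≡ 𝟙 e
𝟙-cong (yes p) (yes _) _   _   = refl
𝟙-cong (yes p) (no ¬q) p⇒q _   = contradiction (p⇒q p) ¬q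
𝟙-cong (no ¬p) (yes q) _   q⇒p = contradiction (q⇒p q) ¬p
𝟙-cong (no _)  (no _)  _   _   = refl

𝟙-× : {P Q : Set} (d : Dec P) (e : Dec Q) → 𝟙 d * 𝟙 e ≡ 𝟙 (d ×-dec e)
𝟙-× (yes _) (yes _) = refl
𝟙-× (yes _) (no _)  = refl
𝟙-× (no _)  _       = refl

count : {A : Set} {P : A → Set} → Decidable P → List A → ℕ
count P? xs = length (filter P? xs)

module _ {A : Set} {P : A → Set} (P? : Decidable P) where

  count-∷ : ∀ x xs → count P? (x ∷ xs) ≡ 𝟙 (P? x) + count P? xs
  count-∷ x xs with P? x
  ... | yes _ = refl
  ... | no _  = refl

  count-++ : ∀ xs ys → count P? (xs ++ ys) ≡ count P? xs + count P? ys
  count-++ xs ys = trans (cong length (filter-++ P? xs ys)) (length-++ (filter P? xs))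

  count-reverse : ∀ xs → count P? (reverse xs) ≡ count P? xs
  count-reverse xs = ↭-length (filter-↭ P? (↭-reverse xs))

  count-none : (∀ x → ¬ P x) → ∀ xs → count P? xs ≡ 0
  count-none ¬P xs = cong length (filter-none P? (All.universal ¬P xs))

count-map : {A B : Set} {P : A → Set} (P? : Decidable P) (f : B → A) → ∀ xs →
            count P? (map f xs) ≡ count (P? ∘ f) xs
count-map P? f []       = refl
count-map P? f (x ∷ xs) = begin
  count P? (f x ∷ map f xs)           ≡⟨ count-∷ P? (f x) (map f xs) ⟩
  𝟙 (P? (f x)) + count P? (map f xs)  ≡⟨ cong (λ z → 𝟙 (P? (f x)) + z) (count-map P? f xs) ⟩
  𝟙 (P? (f x)) + count (P? ∘ f) xs    ≡⟨ count-∷ (P? ∘ f) x xs ⟨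
  count (P? ∘ f) (x ∷ xs)             ∎

count-cong : {A : Set} {P Q : A → Set} (P? : Decidable P) (Q? : Decidable Q) →
             (∀ {x} → P x → Q x) → (∀ {x} → Q x → P x) → ∀ xs → count P? xs ≡ count Q? xs
count-cong P? Q? P⇒Q Q⇒P xs = cong length (filter-≐ P? Q? (P⇒Q , Q⇒P) xs)

count-filter : {A : Set} {P Q : A → Set} (P? : Decidable P) (Q? : Decidable Q) → ∀ xs →
               count Q? (filter P? xs) ≡ count (λ x → P? x ×-dec Q? x) xs
count-filter P? Q? []       = refl
count-filter P? Q? (x ∷ xs) = begin
  count Q? (filter P? (x ∷ xs))                  ≡⟨ head ⟩
  𝟙 (P? x ×-dec Q? x) + count Q? (filter P? xs)  ≡⟨ cong (λ z → 𝟙 (P? x ×-dec Q? x) + z) (count-filter P? Q? xs) ⟩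
  𝟙 (P? x ×-dec Q? x) + count PQ? xs             ≡⟨ count-∷ PQ? x xs ⟨
  count PQ? (x ∷ xs)                             ∎
  where
  PQ? = λ y → P? y ×-dec Q? y
  head : count Q? (filter P? (x ∷ xs)) ≡ 𝟙 (P? x ×-dec Q? x) + count Q? (filter P? xs)
  head with P? x
  ... | yes _ = count-∷ Q? x (filter P? xs)
  ... | no _  = refl

unique-reverse : {A : Set} {xs : List A} → Unique xs → Unique (reverse xs)
unique-reverse {A} {xs} = Permₛ.Unique-resp-↭ (setoid A) (↭⇒↭ₛ (↭-sym (↭-reverse xs)))

all-reverse : {A : Set} {P : A → Set} {xs : List A} → All P xs → All P (reverse xs)
all-reverse {xs = xs} = All-resp-↭ (↭-sym (↭-reverse xs))

count-ʳ++ : {A : Set} {P : A → Set} (P? : Decidable P) → ∀ xs ys → count P? (xs ʳ++ ys) ≡ count P? xs + count P? ys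
count-ʳ++ P? xs ys = begin
  count P? (xs ʳ++ ys)                ≡⟨ cong (count P?) (ʳ++-defn xs) ⟩
  count P? (reverse xs ++ ys)         ≡⟨ count-++ P? (reverse xs) ys ⟩
  count P? (reverse xs) + count P? ys ≡⟨ cong (λ m → m + count P? ys) (count-reverse P? xs) ⟩
  count P? xs + count P? ys           ∎

count-allFin-suc : ∀ {m} {P : Fin (suc m) → Set} (P? : Decidable P) →
                   count P? (allFin (suc m)) ≡ 𝟙 (P? fzero) + count (P? ∘ fsuc) (allFin m)
count-allFin-suc {m} P? = trans (count-∷ P? fzero (tabulate fsuc))
  (cong (λ z → 𝟙 (P? fzero) + z) (trans (cong (count P?) (sym (map-tabulate id fsuc))) (count-map P? fsuc (allFin m))))

count-allFin-single : ∀ {m} {P : Fin m → Set} (P? : Decidable P) (k : Fin m) →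
                      (∀ i → P i → i ≡ k) → count P? (allFin m) ≡ 𝟙 (P? k)
count-allFin-single {suc m} P? fzero only = begin
  count P? (allFin (suc m))                    ≡⟨ count-allFin-suc P? ⟩
  𝟙 (P? fzero) + count (P? ∘ fsuc) (allFin m)  ≡⟨ cong (λ z → 𝟙 (P? fzero) + z) (count-none (P? ∘ fsuc) nowhere (allFin m)) ⟩
  𝟙 (P? fzero) + 0                             ≡⟨ +-identityʳ _ ⟩
  𝟙 (P? fzero)                                 ∎
  where nowhere = λ i p → Finₚ.0≢1+n (sym (only (fsuc i) p))
count-allFin-single {suc m} P? (fsuc k) only = begin
  count P? (allFin (suc m))                    ≡⟨ count-allFin-suc P? ⟩
  𝟙 (P? fzero) + count (P? ∘ fsuc) (allFin m)  ≡⟨ cong₂ _+_ (𝟙-no (P? fzero) (Finₚ.0≢1+n ∘ only fzero))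
                                                    (count-allFin-single (P? ∘ fsuc) k (λ i p → Finₚ.suc-injective (only (fsuc i) p))) ⟩
  𝟙 (P? (fsuc k))                              ∎

count-allFin-prefix : ∀ {m} {P : Fin m → Set} (P? : Decidable P) →
                      (∀ {i j} → toℕ j ≤ toℕ i → P i → P j) →
                      ∀ a → toℕ a < count P? (allFin m) ⇔ P a
count-allFin-prefix {suc m} {P} P? closed a rewrite count-allFin-suc P? with P? fzero
... | no ¬P0 = mk⇔ (λ a<0 → contradiction (subst (toℕ a <_) noneAbove a<0) n≮0) (λ Pa → contradiction (closed z≤n Pa) ¬P0)
  where noneAbove = count-none (P? ∘ fsuc) (λ i → ¬P0 ∘ closed z≤n) (allFin m)
... | yes P0 with a
...   | fzero   = mk⇔ (λ _ → P0) (λ _ → s≤s z≤n)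
...   | fsuc a′ = mk⇔ (to below ∘ ≤-pred) (s≤s ∘ from below)
  where below = count-allFin-prefix (P? ∘ fsuc) (closed ∘ s≤s) a′

colSum : ℕ → (ℕ → ℕ) → ℕ
colSum zero    f = 0
colSum (suc F) f = f (suc F) + colSum F f

sum-columns : ∀ F (f : ℕ → ℕ) → sum (map f (map suc (downFrom F))) ≡ colSum F f
sum-columns zero    f = refl
sum-columns (suc F) f = cong (λ z → f (suc F) + z) (sum-columns F f)

colSum-cong : ∀ F {f g : ℕ → ℕ} → (∀ j → f (suc j) ≡ g (suc j)) → colSum F f ≡ colSum F g
colSum-cong zero    f≗g = refl
colSum-cong (suc F) f≗g = cong₂ _+_ (f≗g F) (colSum-cong F f≗g)

colSum-+ : ∀ F (f g : ℕ → ℕ) → colSum F (λ j → f j + g j) ≡ colSum F f + colSum F g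
colSum-+ zero    f g = refl
colSum-+ (suc F) f g = begin
  (f (suc F) + g (suc F)) + colSum F (λ j → f j + g j)  ≡⟨ cong (λ z → (f (suc F) + g (suc F)) + z) (colSum-+ F f g) ⟩
  (f (suc F) + g (suc F)) + (colSum F f + colSum F g)   ≡⟨ interchange (f (suc F)) (g (suc F)) (colSum F f) (colSum F g) ⟩
  (f (suc F) + colSum F f) + (g (suc F) + colSum F g)   ∎

window : ∀ F {s} x → 1 ≤ s → colSum F (λ j → 𝟙 ((s ≤? j) ×-dec (j ≤? x))) ≡ suc (F ⊓ x) ∸ s
window zero    x 1≤s = sym (m≤n⇒m∸n≡0 1≤s)
window (suc F) {s} x 1≤s = begin
  𝟙 inWindow + colSum F _           ≡⟨ cong (λ z → 𝟙 inWindow + z) (window F x 1≤s) ⟩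
  𝟙 inWindow + (suc (F ⊓ x) ∸ s)    ≡⟨ newColumn (s ≤? suc F) (suc F ≤? x) ⟩
  suc (suc F ⊓ x) ∸ s               ∎
  where
  inWindow = (s ≤? suc F) ×-dec (suc F ≤? x)
  newColumn : Dec (s ≤ suc F) → Dec (suc F ≤ x) → 𝟙 inWindow + (suc (F ⊓ x) ∸ s) ≡ suc (suc F ⊓ x) ∸ s
  newColumn _ (no F≮x) = begin
    𝟙 inWindow + (suc (F ⊓ x) ∸ s)  ≡⟨ cong (_+ (suc (F ⊓ x) ∸ s)) (𝟙-no inWindow (F≮x ∘ proj₂)) ⟩
    suc (F ⊓ x) ∸ s                 ≡⟨ cong (λ m → suc m ∸ s) (trans (m≥n⇒m⊓n≡n x≤F) (sym (m≥n⇒m⊓n≡n (<⇒≤ (s≤s x≤F))))) ⟩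
    suc (suc F ⊓ x) ∸ s             ∎
    where x≤F = ≤-pred (≰⇒> F≮x)
  newColumn (yes s≤F+1) (yes F<x) = begin
    𝟙 inWindow + (suc (F ⊓ x) ∸ s)  ≡⟨ cong₂ (λ i m → i + (suc m ∸ s)) (𝟙-yes inWindow (s≤F+1 , F<x)) (m≤n⇒m⊓n≡m (<⇒≤ F<x)) ⟩
    1 + (suc F ∸ s)                 ≡⟨ +-∸-assoc 1 s≤F+1 ⟨
    suc (suc F) ∸ s                 ≡⟨ cong (λ m → suc m ∸ s) (m≤n⇒m⊓n≡m F<x) ⟨
    suc (suc F ⊓ x) ∸ s             ∎
  newColumn (no s≰F+1) (yes F<x) = begin
    𝟙 inWindow + (suc (F ⊓ x) ∸ s)  ≡⟨ cong₂ (λ i m → i + (suc m ∸ s)) (𝟙-no inWindow (s≰F+1 ∘ proj₁)) (m≤n⇒m⊓n≡m (<⇒≤ F<x)) ⟩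
    suc F ∸ s                       ≡⟨ m≤n⇒m∸n≡0 (<⇒≤ (≰⇒> s≰F+1)) ⟩
    0                               ≡⟨ m≤n⇒m∸n≡0 (≰⇒> s≰F+1) ⟨
    suc (suc F) ∸ s                 ≡⟨ cong (λ m → suc m ∸ s) (m≤n⇒m⊓n≡m F<x) ⟨
    suc (suc F ⊓ x) ∸ s             ∎

module _ {n : ℕ} where

  transpose-left : (a b : Fin n) → PC.transpose a b a ≡ b
  transpose-left a b with a ≟ a
  ... | yes _   = refl
  ... | no a≢a = contradiction refl a≢a

  transpose-right : (a b : Fin n) → PC.transpose a b b ≡ a
  transpose-right a b with b ≟ a
  ... | yes b≡a = b≡a
  ... | no _ with b ≟ b
  ...   | yes _   = refl
  ...   | no b≢b = contradiction refl b≢b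

  transpose-other : (a b p : Fin n) → p ≢ a → p ≢ b → PC.transpose a b p ≡ p
  transpose-other a b p p≢a p≢b with p ≟ a
  ... | yes p≡a = contradiction p≡a p≢a
  ... | no _ with p ≟ b
  ...   | yes p≡b = contradiction p≡b p≢b
  ...   | no _    = refl

  transpose-involutive : (a b p : Fin n) → PC.transpose a b (PC.transpose a b p) ≡ p
  transpose-involutive a b p = byCases (p ≟ a) (p ≟ b)
    where
    byCases : Dec (p ≡ a) → Dec (p ≡ b) → PC.transpose a b (PC.transpose a b p) ≡ p
    byCases (yes refl) _        = trans (cong (PC.transpose p b) (transpose-left p b)) (transpose-right p b)
    byCases (no _)     (yes refl) = trans (cong (PC.transpose a p) (transpose-right a p)) (transpose-left a p)
    byCases (no p≢a)   (no p≢b)   = trans (cong (PC.transpose a b) (transpose-other a b p p≢a p≢b)) (transpose-other a b p p≢a p≢b)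

  -- along p (t₁,…,tₛ) = tₛ(⋯ t₁(p)): the inverse of right multiplication by t₁⋯tₛ
  along : Fin n → List (Fin n × Fin n) → Fin n
  along p []             = p
  along p ((a , b) ∷ ts) = along (PC.transpose a b p) ts

  Inverses : (Fin n → Fin n) → (Fin n → Fin n) → Set
  Inverses f g = (∀ i → g (f i) ≡ i) × (∀ c → f (g c) ≡ c)

  rmul-inverse : ∀ {f g} → Inverses f g → ∀ ts → Inverses (rmul f ts) (λ c → along (g c) ts)
  rmul-inverse inv [] = inv
  rmul-inverse {f} {g} (gf , fg) ((a , b) ∷ ts) = rmul-inverse
    ((λ i → trans (cong (PC.transpose a b) (gf _)) (transpose-involutive a b i))
    , (λ c → trans (cong f (transpose-involutive a b (g c))) (fg c))) ts

  count-preimage : ∀ {P : Fin n → Set} (P? : Decidable P) {π π⁻¹} → Inverses π π⁻¹ → ∀ c →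
                   count (λ i → P? i ×-dec (π i ≟ c)) (allFin n) ≡ 𝟙 (P? (π⁻¹ c))
  count-preimage P? {π} {π⁻¹} (π⁻¹π , ππ⁻¹) c = begin
    count (λ i → P? i ×-dec (π i ≟ c)) (allFin n)  ≡⟨ count-allFin-single _ (π⁻¹ c) (λ i hit → trans (sym (π⁻¹π i)) (cong π⁻¹ (proj₂ hit))) ⟩
    𝟙 (P? (π⁻¹ c) ×-dec (π (π⁻¹ c) ≟ c))           ≡⟨ 𝟙-cong (P? (π⁻¹ c) ×-dec (π (π⁻¹ c) ≟ c)) (P? (π⁻¹ c)) proj₁ (λ p → p , ππ⁻¹ c) ⟩
    𝟙 (P? (π⁻¹ c))                                 ∎

pos-transfer : ∀ {x y z w} → x + y ≡ z + w → + x ≡ + z ℤ.+ (+ w ℤ.- + y)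
pos-transfer {x} {y} {z} {w} eq = begin
  + x                           ≡⟨ cancel (+ x) (+ y) ⟩
  (+ x ℤ.+ + y) ℤ.- + y         ≡⟨ cong (ℤ._- + y) (ℤₚ.pos-+ x y) ⟨
  + (x + y) ℤ.- + y             ≡⟨ cong (λ m → + m ℤ.- + y) eq ⟩
  + (z + w) ℤ.- + y             ≡⟨ cong (ℤ._- + y) (ℤₚ.pos-+ z w) ⟩
  (+ z ℤ.+ + w) ℤ.- + y         ≡⟨ assoc (+ z) (+ w) (+ y) ⟩
  + z ℤ.+ (+ w ℤ.- + y)         ∎
  where
  cancel : ∀ (a b : ℤ) → a ≡ (a ℤ.+ b) ℤ.- b
  cancel = solve-∀
  assoc : ∀ (a b c : ℤ) → (a ℤ.+ b) ℤ.- c ≡ a ℤ.+ (b ℤ.- c)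
  assoc = solve-∀

-- an entry (j , l_k , β_k) of the annotated sequence Γ: segment, multiplicity label, transposition
Entry : ℕ → Set
Entry n = ℕ × ℕ × (Fin n × Fin n)

module ContentFormula {n : ℕ} (λ′ : Fin n → ℕ) where

  F : ℕ
  F = first λ′

  -- the transpositions of the segments j+1, j+2, … (those acting on column j of the filling)
  transpositionsAbove : ℕ → List (Entry n) → List (Fin n × Fin n)
  transpositionsAbove j L = map (λ e → proj₂ (proj₂ e)) (filter (λ e → suc j ≤? proj₁ e) L)

  μL : List (Entry n) → Fin n → ℤ
  μL = foldr (λ e μ → rhat (proj₁ (proj₂ e)) (proj₂ (proj₂ e)) μ) (λ i → + λ′ i)

  -- the number of boxes of row x lying in the columns s, s+1, … (for s ≥ 1)
  reach : ℕ → Fin n → ℕ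
  reach s x = suc (λ′ x) ∸ s

  Labelled : Entry n → Set
  Labelled (s , l , (a , b)) = λ′ b < s × s ≤ λ′ a × l ≡ reach s a

  SegmentOrder : Entry n → Entry n → Set
  SegmentOrder e e′ = proj₁ e′ ≤ proj₁ e

  -- Σ_j [ j ≤ λ(along p (transpositions above j)) ]; for p = w⁻¹(c) this is the number of
  -- cells of the filling f(w,T) containing c
  columnCount : Fin n → List (Entry n) → ℕ
  columnCount p L = colSum F (λ j → 𝟙 (j ≤? λ′ (along p (transpositionsAbove j L))))

  rhat-left : ∀ l a b (μ : Fin n → ℤ) → rhat l (a , b) μ a ≡ μ b ℤ.+ + l
  rhat-left l a b μ with a ≟ a
  ... | yes _   = refl
  ... | no a≢a = contradiction refl a≢a

  rhat-right : ∀ l a b (μ : Fin n → ℤ) → b ≢ a → rhat l (a , b) μ b ≡ μ a ℤ.- + l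
  rhat-right l a b μ b≢a with b ≟ a
  ... | yes b≡a = contradiction b≡a b≢a
  ... | no _ with b ≟ b
  ...   | yes _   = refl
  ...   | no b≢b = contradiction refl b≢b

  rhat-other : ∀ l a b (μ : Fin n → ℤ) p → p ≢ a → p ≢ b → rhat l (a , b) μ p ≡ μ p
  rhat-other l a b μ p p≢a p≢b with p ≟ a
  ... | yes p≡a = contradiction p≡a p≢a
  ... | no _ with p ≟ b
  ...   | yes p≡b = contradiction p≡b p≢b
  ...   | no _    = refl

  -- For a labelled entry, r̂ is "permute by (a,b), then correct by the difference of reaches".
  rhat-transpose : ∀ {s l a b} → Labelled (s , l , (a , b)) → ∀ (μ : Fin n → ℤ) p →
    rhat l (a , b) μ p ≡ μ (PC.transpose a b p) ℤ.+ (+ reach s p ℤ.- + reach s (PC.transpose a b p))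
  rhat-transpose {s} {l} {a} {b} (b<s , s≤a , l≡reach) μ p = byCases (p ≟ a) (p ≟ b)
    where
    t = PC.transpose a b
    shift : ℤ → ℤ
    shift q = + reach s p ℤ.- q
    b-empty : reach s b ≡ 0
    b-empty = m≤n⇒m∸n≡0 b<s
    b≢a : b ≢ a
    b≢a refl = n≮n _ (<-≤-trans b<s s≤a)
    byCases : Dec (p ≡ a) → Dec (p ≡ b) → rhat l (a , b) μ p ≡ μ (t p) ℤ.+ (+ reach s p ℤ.- + reach s (t p))
    byCases (yes refl) _ = begin
      rhat l (p , b) μ p                            ≡⟨ rhat-left l p b μ ⟩
      μ b ℤ.+ + l                                   ≡⟨ cong (λ m → μ b ℤ.+ + m) l≡reach ⟩
      μ b ℤ.+ + reach s p                           ≡⟨ cong (λ z → μ b ℤ.+ z) (ℤₚ.+-identityʳ _) ⟨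
      μ b ℤ.+ shift (+ 0)                           ≡⟨ cong (λ m → μ b ℤ.+ shift (+ m)) b-empty ⟨
      μ b ℤ.+ shift (+ reach s b)                   ≡⟨ cong (λ q → μ q ℤ.+ shift (+ reach s q)) (transpose-left p b) ⟨
      μ (t p) ℤ.+ shift (+ reach s (t p))           ∎
    byCases (no _) (yes refl) = begin
      rhat l (a , p) μ p                            ≡⟨ rhat-right l a p μ b≢a ⟩
      μ a ℤ.- + l                                   ≡⟨ cong (λ m → μ a ℤ.+ ℤ.- + m) l≡reach ⟩
      μ a ℤ.+ ℤ.- + reach s a                       ≡⟨ cong (λ z → μ a ℤ.+ z) (ℤₚ.+-identityˡ _) ⟨
      μ a ℤ.+ (+ 0 ℤ.- + reach s a)                 ≡⟨ cong (λ m → μ a ℤ.+ (+ m ℤ.- + reach s a)) b-empty ⟨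
      μ a ℤ.+ shift (+ reach s a)                   ≡⟨ cong (λ q → μ q ℤ.+ shift (+ reach s q)) (transpose-right a p) ⟨
      μ (t p) ℤ.+ shift (+ reach s (t p))           ∎
    byCases (no p≢a) (no p≢b) = begin
      rhat l (a , b) μ p                            ≡⟨ rhat-other l a b μ p p≢a p≢b ⟩
      μ p                                           ≡⟨ ℤₚ.+-identityʳ (μ p) ⟨
      μ p ℤ.+ + 0                                   ≡⟨ cong (λ z → μ p ℤ.+ z) (ℤₚ.+-inverseʳ (+ reach s p)) ⟨
      μ p ℤ.+ shift (+ reach s p)                   ≡⟨ cong (λ q → μ q ℤ.+ shift (+ reach s q)) (transpose-other a b p p≢a p≢b) ⟨
      μ (t p) ℤ.+ shift (+ reach s (t p))           ∎

  -- Column j of the list e ∷ L, e in segment s: left of s the row is moved by (a,b);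
  -- from column s on nothing acts and the two rows p and (a,b)(p) trade places.
  column-step : ∀ {s l a b} L → All (λ e → proj₁ e ≤ s) L → ∀ p j →
    𝟙 (j ≤? λ′ (along p (transpositionsAbove j ((s , l , (a , b)) ∷ L))))
      + 𝟙 ((s ≤? j) ×-dec (j ≤? λ′ (PC.transpose a b p)))
    ≡ 𝟙 (j ≤? λ′ (along (PC.transpose a b p) (transpositionsAbove j L)))
      + 𝟙 ((s ≤? j) ×-dec (j ≤? λ′ p))
  column-step {s} {l} {a} {b} L below p j = byCases (suc j ≤? s)
    where
    t = PC.transpose a b
    e = (s , l , (a , b))
    height : Fin n → List (Fin n × Fin n) → ℕ
    height q ts = 𝟙 (j ≤? λ′ (along q ts))
    gate : Fin n → ℕ
    gate q = 𝟙 ((s ≤? j) ×-dec (j ≤? λ′ q))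
    byCases : Dec (suc j ≤ s) → height p (transpositionsAbove j (e ∷ L)) + gate (t p) ≡ height (t p) (transpositionsAbove j L) + gate p
    byCases (yes j<s) = begin
      height p (transpositionsAbove j (e ∷ L)) + gate (t p)  ≡⟨ cong₂ _+_ (cong (height p ∘ map _) (filter-accept (λ e → suc j ≤? proj₁ e) j<s)) (closed (t p)) ⟩
      height (t p) (transpositionsAbove j L) + 0             ≡⟨ cong (λ z → height (t p) (transpositionsAbove j L) + z) (closed p) ⟨
      height (t p) (transpositionsAbove j L) + gate p        ∎
      where
      closed : ∀ q → gate q ≡ 0
      closed q = 𝟙-no ((s ≤? j) ×-dec (j ≤? λ′ q)) (<⇒≱ j<s ∘ proj₁)
    byCases (no j≮s) = begin
      height p (transpositionsAbove j (e ∷ L)) + gate (t p)  ≡⟨ cong₂ _+_ (cong (height p ∘ map _) (trans (filter-reject (λ e → suc j ≤? proj₁ e) j≮s) nothingAbove)) (open′ (t p)) ⟩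
      height p [] + height (t p) []                          ≡⟨ +-comm (height p []) _ ⟩
      height (t p) [] + height p []                          ≡⟨ cong₂ _+_ (cong (height (t p) ∘ map _) nothingAbove) (open′ p) ⟨
      height (t p) (transpositionsAbove j L) + gate p        ∎
      where
      s≤j : s ≤ j
      s≤j = ≤-pred (≰⇒> j≮s)
      nothingAbove : filter (λ e → suc j ≤? proj₁ e) L ≡ []
      nothingAbove = filter-none (λ e → suc j ≤? proj₁ e) (All.map (λ e≤s j<e → n≮n j (≤-trans j<e (≤-trans e≤s s≤j))) below)
      open′ : ∀ q → gate q ≡ height q []
      open′ q = 𝟙-cong ((s ≤? j) ×-dec (j ≤? λ′ q)) (j ≤? λ′ q) proj₂ (s≤j ,_)

  -- Summing column-step over all columns, using the window count for the two gates.
  columnCount-step : ∀ {s l a b} → 1 ≤ s → (∀ i → λ′ i ≤ F) → ∀ L → All (λ e → proj₁ e ≤ s) L → ∀ p →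
    columnCount p ((s , l , (a , b)) ∷ L) + reach s (PC.transpose a b p)
    ≡ columnCount (PC.transpose a b p) L + reach s p
  columnCount-step {s} {l} {a} {b} 1≤s bounded L below p = begin
    columnCount p (e ∷ L) + reach s (t p)                ≡⟨ cong (λ z → columnCount p (e ∷ L) + z) (gated (t p)) ⟨
    columnCount p (e ∷ L) + colSum F (gate (t p))        ≡⟨ colSum-+ F _ _ ⟨
    colSum F (λ j → _ + gate (t p) j)                    ≡⟨ colSum-cong F (λ j → column-step L below p (suc j)) ⟩
    colSum F (λ j → _ + gate p j)                        ≡⟨ colSum-+ F _ _ ⟩
    columnCount (t p) L + colSum F (gate p)              ≡⟨ cong (λ z → columnCount (t p) L + z) (gated p) ⟩
    columnCount (t p) L + reach s p                      ∎
    where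
    t = PC.transpose a b
    e = (s , l , (a , b))
    gate : Fin n → ℕ → ℕ
    gate q j = 𝟙 ((s ≤? j) ×-dec (j ≤? λ′ q))
    gated : ∀ q → colSum F (gate q) ≡ reach s q
    gated q = trans (window F (λ′ q) 1≤s) (cong (λ m → suc m ∸ s) (m≥n⇒m⊓n≡n (bounded q)))

  columnCount-[] : (∀ i → λ′ i ≤ F) → ∀ p → columnCount p [] ≡ λ′ p
  columnCount-[] bounded p = begin
    colSum F (λ j → 𝟙 (j ≤? λ′ p))                      ≡⟨ colSum-cong F (λ j → 𝟙-cong (suc j ≤? λ′ p) ((1 ≤? suc j) ×-dec (suc j ≤? λ′ p)) (s≤s z≤n ,_) proj₂) ⟩
    colSum F (λ j → 𝟙 ((1 ≤? j) ×-dec (j ≤? λ′ p)))     ≡⟨ window F (λ′ p) (s≤s z≤n) ⟩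
    F ⊓ λ′ p                                            ≡⟨ m≥n⇒m⊓n≡n (bounded p) ⟩
    λ′ p                                                ∎

  content-formula : (∀ i → λ′ i ≤ F) → ∀ L → AllPairs SegmentOrder L → All Labelled L →
                    ∀ p → + columnCount p L ≡ μL L p
  content-formula bounded [] _ _ p = cong +_ (columnCount-[] bounded p)
  content-formula bounded ((s , l , (a , b)) ∷ L) (ordered ∷ ordered′) (label ∷ labels) p = begin
    + columnCount p ((s , l , (a , b)) ∷ L)                            ≡⟨ pos-transfer (columnCount-step 1≤s bounded L ordered p) ⟩
    + columnCount (t p) L ℤ.+ (+ reach s p ℤ.- + reach s (t p))        ≡⟨ cong (λ z → z ℤ.+ (+ reach s p ℤ.- + reach s (t p))) (content-formula bounded L ordered′ labels (t p)) ⟩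
    μL L (t p) ℤ.+ (+ reach s p ℤ.- + reach s (t p))                   ≡⟨ rhat-transpose label (μL L) p ⟨
    μL ((s , l , (a , b)) ∷ L) p                                       ∎
    where
    t = PC.transpose a b
    1≤s = ≤-trans (s≤s z≤n) (proj₁ label)

  -- c occurs in column j of f(w,T) iff row π_j⁻¹(c) reaches column j; summing over j gives the content.
  ct-filling : ∀ w T c → ct λ′ (filling λ′ w T) c ≡ columnCount (w ⟨$⟩ˡ c) (selected λ′ T)
  ct-filling w T c = trans (sum-columns F _) (colSum-cong F (λ j →
    count-preimage (λ i → suc j ≤? λ′ i)
      (rmul-inverse ((λ _ → inverseˡ w) , (λ _ → inverseʳ w)) (transpositionsAbove (suc j) (selected λ′ T))) c))

  ct-cong : ∀ σ σ′ → (∀ i j → IsCell λ′ i j → σ i j ≡ σ′ i j) → ∀ c → ct λ′ σ c ≡ ct λ′ σ′ c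
  ct-cong σ σ′ agree c = trans (sum-columns F _) (trans (colSum-cong F (λ j →
      count-cong _ _ (λ {i} (inRow , hit) → inRow , trans (sym (agree i (suc j) (s≤s z≤n , inRow))) hit)
                     (λ {i} (inRow , hit) → inRow , trans (agree i (suc j) (s≤s z≤n , inRow)) hit) (allFin n)))
    (sym (sum-columns F _)))

module _ {n : ℕ} where

  rowsAbove rowsBelow : ℕ → List (Fin n)
  rowsAbove c = filter (λ a → suc (toℕ a) ≤? c) (allFin n)
  rowsBelow c = reverse (filter (λ b → c ≤? toℕ b) (allFin n))

  Γk-cartesian : ∀ c → Γk c ≡ cartesianProduct (rowsAbove c) (rowsBelow c)
  Γk-cartesian c = go (rowsAbove c)
    where
    go : ∀ as → concatMap (λ a → map (a ,_) (rowsBelow c)) as ≡ cartesianProduct as (rowsBelow c)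
    go []       = refl
    go (a ∷ as) = cong (map (a ,_) (rowsBelow c) ++_) (go as)

  Γk-unique : ∀ c → Unique (Γk c)
  Γk-unique c = subst Unique (sym (Γk-cartesian c))
    (Uniqueₚ.cartesianProduct⁺ (Uniqueₚ.filter⁺ _ (Uniqueₚ.allFin⁺ n))
                               (unique-reverse (Uniqueₚ.filter⁺ _ (Uniqueₚ.allFin⁺ n))))

  Γk-bounds : ∀ c → All (λ ab → toℕ (proj₁ ab) < c × c ≤ toℕ (proj₂ ab)) (Γk c)
  Γk-bounds c = subst (All _) (sym (Γk-cartesian c))
    (Allₚ.cartesianProduct⁺ (setoid (Fin n)) (setoid (Fin n)) (rowsAbove c) (rowsBelow c)
      (λ a∈ b∈ → All.lookup (Allₚ.all-filter _ (allFin n)) a∈ , All.lookup (all-reverse (Allₚ.all-filter _ (allFin n))) b∈))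

  count-cartesian : ∀ (a b : Fin n) xs ys → count (pairEq? (a , b)) (cartesianProduct xs ys) ≡ count (a ≟_) xs * count (b ≟_) ys
  count-cartesian a b []       ys = refl
  count-cartesian a b (x ∷ xs) ys = begin
    count ab? (map (x ,_) ys ++ cartesianProduct xs ys)                ≡⟨ count-++ ab? (map (x ,_) ys) _ ⟩
    count ab? (map (x ,_) ys) + count ab? (cartesianProduct xs ys)     ≡⟨ cong₂ _+_ (trans (count-map ab? (x ,_) ys) (row (a ≟ x))) (count-cartesian a b xs ys) ⟩
    𝟙 (a ≟ x) * count (b ≟_) ys + count (a ≟_) xs * count (b ≟_) ys  ≡⟨ *-distribʳ-+ (count (b ≟_) ys) (𝟙 (a ≟ x)) _ ⟨
    (𝟙 (a ≟ x) + count (a ≟_) xs) * count (b ≟_) ys                  ≡⟨ cong (λ m → m * count (b ≟_) ys) (count-∷ (a ≟_) x xs) ⟨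
    count (a ≟_) (x ∷ xs) * count (b ≟_) ys                          ∎
    where
    ab? = pairEq? (a , b)
    row : (d : Dec (a ≡ x)) → count (ab? ∘ (x ,_)) ys ≡ 𝟙 d * count (b ≟_) ys
    row (yes refl) = trans (count-cong _ (b ≟_) (cong proj₂) (cong (a ,_)) ys) (sym (+-identityʳ _))
    row (no a≢x)   = count-none _ (λ y ab≡xy → a≢x (cong proj₁ ab≡xy)) ys

  count-in-filter : ∀ {P : Fin n → Set} (P? : Decidable P) a → count (a ≟_) (filter P? (allFin n)) ≡ 𝟙 (P? a)
  count-in-filter P? a = begin
    count (a ≟_) (filter P? (allFin n))              ≡⟨ count-filter P? (a ≟_) (allFin n) ⟩
    count (λ i → P? i ×-dec (a ≟ i)) (allFin n)      ≡⟨ count-allFin-single _ a (λ i hit → sym (proj₂ hit)) ⟩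
    𝟙 (P? a ×-dec (a ≟ a))                           ≡⟨ 𝟙-cong (P? a ×-dec (a ≟ a)) (P? a) proj₁ (_, refl) ⟩
    𝟙 (P? a)                                         ∎

  count-Γk : ∀ c (a b : Fin n) → count (pairEq? (a , b)) (Γk c) ≡ 𝟙 ((suc (toℕ a) ≤? c) ×-dec (c ≤? toℕ b))
  count-Γk c a b = begin
    count (pairEq? (a , b)) (Γk c)                                      ≡⟨ cong (count (pairEq? (a , b))) (Γk-cartesian c) ⟩
    count (pairEq? (a , b)) (cartesianProduct (rowsAbove c) (rowsBelow c)) ≡⟨ count-cartesian a b (rowsAbove c) (rowsBelow c) ⟩
    count (a ≟_) (rowsAbove c) * count (b ≟_) (rowsBelow c)             ≡⟨ cong₂ _*_ (count-in-filter (λ a → suc (toℕ a) ≤? c) a)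
        (trans (count-reverse (b ≟_) (filter (λ b → c ≤? toℕ b) (allFin n))) (count-in-filter (λ b → c ≤? toℕ b) b)) ⟩
    𝟙 (suc (toℕ a) ≤? c) * 𝟙 (c ≤? toℕ b)                               ≡⟨ 𝟙-× (suc (toℕ a) ≤? c) (c ≤? toℕ b) ⟩
    𝟙 ((suc (toℕ a) ≤? c) ×-dec (c ≤? toℕ b))                           ∎

module _ {n : ℕ} where

  annotate : List (Fin n × Fin n) → List (ℕ × (Fin n × Fin n)) → List (Entry n)
  annotate seen []            = []
  annotate seen ((j , x) ∷ S) = (j , suc (count (pairEq? x) seen) , x) ∷ annotate (x ∷ seen) S

  zip-annotate : ∀ seen S → zip3 {n = n} (map proj₁ S) (lCounts seen (map proj₂ S)) (map proj₂ S) ≡ annotate seen S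
  zip-annotate seen []            = refl
  zip-annotate seen ((j , x) ∷ S) = cong (_ ∷_) (zip-annotate (x ∷ seen) S)

  annotate-++ : ∀ seen S₁ S₂ → annotate seen (S₁ ++ S₂) ≡ annotate seen S₁ ++ annotate (map proj₂ S₁ ʳ++ seen) S₂
  annotate-++ seen []             S₂ = refl
  annotate-++ seen ((j , x) ∷ S₁) S₂ = cong (_ ∷_) (annotate-++ (x ∷ seen) S₁ S₂)

  annotate-segments : ∀ seen S → map proj₁ (annotate seen S) ≡ map proj₁ S
  annotate-segments seen []            = refl
  annotate-segments seen ((j , x) ∷ S) = cong (j ∷_) (annotate-segments (x ∷ seen) S)

  annotate-block : ∀ s seen {xs} → Unique xs →
                   annotate seen (map (s ,_) xs) ≡ map (λ x → (s , suc (count (pairEq? x) seen) , x)) xs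
  annotate-block s seen []                  = refl
  annotate-block s seen {x ∷ xs} (x∉xs ∷ u) = cong (_ ∷_) (trans (annotate-block s (x ∷ seen) u)
    (map-cong-local (All.map (λ x≢y → cong (λ m → s , suc m , _) (skip x≢y)) x∉xs)))
    where
    skip : ∀ {y} → ¬ x ≡ y → count (pairEq? y) (x ∷ seen) ≡ count (pairEq? y) seen
    skip {y} x≢y = trans (count-∷ (pairEq? y) x seen) (cong (_+ count (pairEq? y) seen) (𝟙-no (pairEq? y x) (x≢y ∘ sym)))

  map-proj₂ : ∀ (s : ℕ) (xs : List (Fin n × Fin n)) → map proj₂ (map (s ,_) xs) ≡ xs
  map-proj₂ s xs = trans (sym (map-∘ xs)) (map-id xs)

  blocks-descending : ∀ (block : ℕ → List (Fin n × Fin n)) js → AllPairs (λ j j′ → j′ ≤ j) js →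
                      AllPairs (λ e e′ → proj₁ e′ ≤ proj₁ e) (concatMap (λ j → map (j ,_) (block j)) js)
  blocks-descending block []       []                = []
  blocks-descending block (j ∷ js) (js≤j ∷ js-desc) =
    AllPairsₚ.++⁺ (within (block j)) (blocks-descending block js js-desc)
                  (Allₚ.map⁺ (All.universal (λ _ → later) (block j)))
    where
    within : ∀ xs → AllPairs (λ e e′ → proj₁ e′ ≤ proj₁ e) (map (j ,_) xs)
    within []       = []
    within (x ∷ xs) = Allₚ.map⁺ (All.universal (λ _ → ≤-refl) xs) ∷ within xs
    later : All (λ e → proj₁ e ≤ j) (concatMap (λ j → map (j ,_) (block j)) js)
    later = Allₚ.concat⁺ (Allₚ.map⁺ (All.map (λ j′≤j → Allₚ.map⁺ (All.universal (λ _ → j′≤j) _)) js≤j))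

  select-All : ∀ {A : Set} {P : A → Set} xs (bs : List Bool) → All P xs → All P (select {n = n} xs bs)
  select-All []       bs           _          = []
  select-All (x ∷ xs) []           _          = []
  select-All (x ∷ xs) (true ∷ bs)  (px ∷ pxs) = px ∷ select-All xs bs pxs
  select-All (x ∷ xs) (false ∷ bs) (_ ∷ pxs)  = select-All xs bs pxs

  select-AllPairs : ∀ {A : Set} {R : A → A → Set} xs (bs : List Bool) → AllPairs R xs → AllPairs R (select {n = n} xs bs)
  select-AllPairs []       bs           _          = []
  select-AllPairs (x ∷ xs) []           _          = []
  select-AllPairs (x ∷ xs) (true ∷ bs)  (rx ∷ rxs) = select-All xs bs rx ∷ select-AllPairs xs bs rxs
  select-AllPairs (x ∷ xs) (false ∷ bs) (_ ∷ rxs)  = select-AllPairs xs bs rxs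

partition-bounded : ∀ {n} {λ′ : Fin n → ℕ} → IsPartition λ′ → ∀ i → λ′ i ≤ first λ′
partition-bounded {suc m} partition i = partition fzero i z≤n

module GammaStructure {n : ℕ} (λ′ : Fin n → ℕ) (partition : IsPartition λ′) where
  open ContentFormula λ′

  conj-threshold : ∀ s a → toℕ a < conj λ′ s ⇔ s ≤ λ′ a
  conj-threshold s a = count-allFin-prefix (λ i → s ≤? λ′ i) (λ j≤i s≤λi → ≤-trans s≤λi (partition _ _ j≤i)) a

  conj-threshold-complement : ∀ s b → conj λ′ s ≤ toℕ b ⇔ λ′ b < s
  conj-threshold-complement s b = mk⇔
    (λ c≤b → ≰⇒> (λ s≤λb → <⇒≱ (from (conj-threshold s b) s≤λb) c≤b))
    (λ λb<s → ≮⇒≥ (λ b<c → <⇒≱ λb<s (to (conj-threshold s b) b<c)))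

  segment : ℕ → List (ℕ × (Fin n × Fin n))
  segment j = map (j ,_) (Γk (conj λ′ j))

  occ : Fin n → Fin n → ℕ → ℕ
  occ a b j = count (pairEq? (a , b)) (Γk (conj λ′ j))

  occurrences : ∀ j a b → occ a b j ≡ 𝟙 ((suc (λ′ b) ≤? j) ×-dec (j ≤? λ′ a))
  occurrences j a b = trans (count-Γk (conj λ′ j) a b)
    (𝟙-cong ((suc (toℕ a) ≤? conj λ′ j) ×-dec (conj λ′ j ≤? toℕ b)) ((suc (λ′ b) ≤? j) ×-dec (j ≤? λ′ a))
      (λ (a<c , c≤b) → to (conj-threshold-complement j b) c≤b , to (conj-threshold j a) a<c)
      (λ (λb<j , j≤λa) → from (conj-threshold j a) j≤λa , from (conj-threshold-complement j b) λb<j))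

  occurrences-up-to : ∀ m a b → colSum m (occ a b) ≡ m ⊓ λ′ a ∸ λ′ b
  occurrences-up-to m a b = trans (colSum-cong m (λ j → occurrences (suc j) a b)) (window m {suc (λ′ b)} (λ′ a) (s≤s z≤n))

  -- seen consists of exactly the occurrences in the segments Γ_F,…,Γ_{m+1}
  SeenAbove : ℕ → List (Fin n × Fin n) → Set
  SeenAbove m seen = ∀ a b → count (pairEq? (a , b)) seen + colSum m (occ a b) ≡ colSum F (occ a b)

  seenAbove-step : ∀ m seen → SeenAbove (suc m) seen → SeenAbove m (map proj₂ (segment (suc m)) ʳ++ seen)
  seenAbove-step m seen above a b = begin
    count ab? (map proj₂ (segment (suc m)) ʳ++ seen) + colSum m (occ a b)
      ≡⟨ cong (_+ colSum m (occ a b)) (trans (count-ʳ++ ab? (map proj₂ (segment (suc m))) seen)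
           (cong (λ ys → count ab? ys + count ab? seen) (map-proj₂ (suc m) (Γk (conj λ′ (suc m)))))) ⟩
    (occ a b (suc m) + count ab? seen) + colSum m (occ a b)
      ≡⟨ trans (cong (_+ colSum m (occ a b)) (+-comm (occ a b (suc m)) _)) (+-assoc (count ab? seen) _ _) ⟩
    count ab? seen + colSum (suc m) (occ a b)
      ≡⟨ above a b ⟩
    colSum F (occ a b) ∎
    where ab? = pairEq? (a , b)

  -- The entries of a segment are labelled: the earlier occurrences of (a,b) are those in Γ_{s+1},…,Γ_{λ_a}.
  labelled-segment : ∀ s seen → SeenAbove s seen → All Labelled (annotate seen (segment s))
  labelled-segment s seen above = subst (All Labelled) (sym (annotate-block s seen (Γk-unique (conj λ′ s))))
    (Allₚ.map⁺ (All.map label (Γk-bounds (conj λ′ s))))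
    where
    label : ∀ {x} → toℕ (proj₁ x) < conj λ′ s × conj λ′ s ≤ toℕ (proj₂ x) → Labelled (s , suc (count (pairEq? x) seen) , x)
    label {a , b} (a<c , c≤b) = λb<s , s≤λa , (begin
        suc (count (pairEq? (a , b)) seen)  ≡⟨ cong suc earlier ⟩
        suc (λ′ a ∸ s)                      ≡⟨ +-∸-assoc 1 s≤λa ⟨
        reach s a                           ∎)
      where
      λb<s = to (conj-threshold-complement s b) c≤b
      s≤λa = to (conj-threshold s a) a<c
      earlier : count (pairEq? (a , b)) seen ≡ λ′ a ∸ s
      earlier = +-cancelʳ-≡ (s ∸ λ′ b) _ _ (begin
        count (pairEq? (a , b)) seen + (s ∸ λ′ b)     ≡⟨ cong (λ m → count (pairEq? (a , b)) seen + (m ∸ λ′ b)) (m≤n⇒m⊓n≡m s≤λa) ⟨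
        count (pairEq? (a , b)) seen + (s ⊓ λ′ a ∸ λ′ b) ≡⟨ cong (λ m → count (pairEq? (a , b)) seen + m) (occurrences-up-to s a b) ⟨
        count (pairEq? (a , b)) seen + colSum s (occ a b) ≡⟨ above a b ⟩
        colSum F (occ a b)                            ≡⟨ occurrences-up-to F a b ⟩
        F ⊓ λ′ a ∸ λ′ b                               ≡⟨ cong (_∸ λ′ b) (m≥n⇒m⊓n≡n (partition-bounded partition a)) ⟩
        λ′ a ∸ λ′ b                                   ≡⟨ cong (_∸ λ′ b) (m∸n+n≡m s≤λa) ⟨
        (λ′ a ∸ s) + s ∸ λ′ b                         ≡⟨ +-∸-assoc (λ′ a ∸ s) (<⇒≤ λb<s) ⟩
        (λ′ a ∸ s) + (s ∸ λ′ b)                       ∎)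

  labelled-from : ∀ m seen → SeenAbove m seen → All Labelled (annotate seen (concatMap segment (map suc (downFrom m))))
  labelled-from zero    seen _     = []
  labelled-from (suc m) seen above = subst (All Labelled) (sym (annotate-++ seen (segment (suc m)) _))
    (Allₚ.++⁺ (labelled-segment (suc m) seen above) (labelled-from m _ (seenAbove-step m seen above)))

  Γ-labelled : All Labelled (ΓAnn λ′)
  Γ-labelled = subst (All Labelled) (sym (zip-annotate [] (ΓSeg λ′))) (labelled-from F [] (λ a b → refl))

  Γ-ordered : AllPairs SegmentOrder (ΓAnn λ′)
  Γ-ordered = subst (AllPairs SegmentOrder) (sym (zip-annotate [] (ΓSeg λ′)))
    (AllPairsₚ.map⁻ (subst (AllPairs (λ j j′ → j′ ≤ j)) (sym (annotate-segments [] (ΓSeg λ′)))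
      (AllPairsₚ.map⁺ (blocks-descending (Γk ∘ conj λ′) (map suc (downFrom F)) columns-descending))))
    where
    columns-descending : AllPairs (λ j j′ → j′ ≤ j) (map suc (downFrom F))
    columns-descending = AllPairsₚ.map⁺ (AllPairsₚ.applyDownFrom⁺₁ id F (λ j<i _ → s≤s (<⇒≤ j<i)))

proposition3p6 : (n : ℕ) → 2 ≤ n → (λ′ : Fin n → ℕ) → IsPartition λ′ → nonzeroParts λ′ ≤ n ∸ 1 →
    (w : Permutation′ n) → (T : Subseq λ′) →
      ((c : Fin n) → + (ct λ′ (filling λ′ w T) c) ≡ act w (μT λ′ T) c)
      × ((w′ : Permutation′ n) → (T′ : Subseq λ′) →
          ((i : Fin n) → (j : ℕ) → IsCell λ′ i j → filling λ′ w T i j ≡ filling λ′ w′ T′ i j) →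
          (c : Fin n) → act w (μT λ′ T) c ≡ act w′ (μT λ′ T′) c)
proposition3p6 n _ λ′ partition _ w T = content w T , determined
  where
  open ContentFormula λ′
  open GammaStructure λ′ partition
  content : ∀ w T c → + ct λ′ (filling λ′ w T) c ≡ act w (μT λ′ T) c
  content w T c = begin
    + ct λ′ (filling λ′ w T) c                ≡⟨ cong +_ (ct-filling w T c) ⟩
    + columnCount (w ⟨$⟩ˡ c) (selected λ′ T)  ≡⟨ content-formula (partition-bounded partition) (selected λ′ T)
                                                   (select-AllPairs {n = n} (ΓAnn λ′) (toList T) Γ-ordered)
                                                   (select-All {n = n} (ΓAnn λ′) (toList T) Γ-labelled) (w ⟨$⟩ˡ c) ⟩
    act w (μT λ′ T) c                         ∎
  determined : ∀ w′ T′ → (∀ i j → IsCell λ′ i j → filling λ′ w T i j ≡ filling λ′ w′ T′ i j) →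
               ∀ c → act w (μT λ′ T) c ≡ act w′ (μT λ′ T′) c
  determined w′ T′ agree c = begin
    act w (μT λ′ T) c              ≡⟨ content w T c ⟨
    + ct λ′ (filling λ′ w T) c     ≡⟨ cong +_ (ct-cong (filling λ′ w T) (filling λ′ w′ T′) agree c) ⟩
    + ct λ′ (filling λ′ w′ T′) c   ≡⟨ content w′ T′ c ⟩
    act w′ (μT λ′ T′) c            ∎
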